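{- Let $G$ be an odd cycle disjoint graph. Then each connected component of $G[D(G)]$ is either an isolated vertex or an odd cycle.
   Context: All graphs are finite, simple and undirected. A graph is odd cycle disjoint if every two distinct odd cycles $C,C'$ of $G$ satisfy $V(C)\cap V(C')=\emptyset$. $D(G)$ is the set of vertices $v$ of $G$ for which some maximum matching of $G$ does not cover $v$. -}

module Defs where

open import Data.Nat using (ℕ; suc; _≤_; _%_)
open import Data.Fin using (Fin)
open import Data.Bool using (Bool; true; false)
open import Data.List using (List; []; _∷_; length; zip; _++_; [_]; concatMap)
open import Data.List.Membership.Propositional using (_∈_)
open import Data.List.Relation.Unary.All using (All)
open import Data.List.Relation.Unary.Unique.Propositional using (Unique)
open import Data.Product using (Σ; _×_; _,_; proj₁; proj₂)
open import Data.Sum using (_⊎_)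
open import Relation.Binary.PropositionalEquality using (_≡_)
open import Relation.Nullary using (¬_)
open import Function.Bundles using (_⇔_)
import Data.Empty

record Graph (n : ℕ) : Set where
  field
    adj    : Fin n → Fin n → Bool
    sym    : ∀ u v → adj u v ≡ adj v u
    irrefl : ∀ v → adj v v ≡ false
open Graph public

module _ {n : ℕ} (G : Graph n) where

  Adj : Fin n → Fin n → Set
  Adj u v = adj G u v ≡ true

  cycPairs : List (Fin n) → List (Fin n × Fin n)
  cycPairs []       = []
  cycPairs (x ∷ xs) = zip (x ∷ xs) (xs ++ [ x ])

  CycEdge : List (Fin n) → Fin n → Fin n → Set
  CycEdge C u w = ((u , w) ∈ cycPairs C) ⊎ ((w , u) ∈ cycPairs C)

  IsCycle : List (Fin n) → Set
  IsCycle C = Unique C × (3 ≤ length C) × All (λ p → Adj (proj₁ p) (proj₂ p)) (cycPairs C)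

  IsOddCycle : List (Fin n) → Set
  IsOddCycle C = IsCycle C × (length C % 2 ≡ 1)

  -- two cycles are the same (sub)graph iff they have the same edge set
  SameCycle : List (Fin n) → List (Fin n) → Set
  SameCycle C C' = ∀ u w → CycEdge C u w ⇔ CycEdge C' u w

  OddCycleDisjoint : Set
  OddCycleDisjoint = ∀ C C' → IsOddCycle C → IsOddCycle C' →
    ¬ SameCycle C C' → ∀ v → v ∈ C → v ∈ C' → Data.Empty.⊥

  endpoints : List (Fin n × Fin n) → List (Fin n)
  endpoints = concatMap (λ p → proj₁ p ∷ proj₂ p ∷ [])

  IsMatching : List (Fin n × Fin n) → Set
  IsMatching M = All (λ p → Adj (proj₁ p) (proj₂ p)) M × Unique (endpoints M)

  IsMaximumMatching : List (Fin n × Fin n) → Set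
  IsMaximumMatching M = IsMatching M × (∀ M' → IsMatching M' → length M' ≤ length M)

  Covers : List (Fin n × Fin n) → Fin n → Set
  Covers M v = v ∈ endpoints M

  InD : Fin n → Set
  InD v = Σ (List (Fin n × Fin n)) λ M → IsMaximumMatching M × ¬ Covers M v

  data ReachD : Fin n → Fin n → Set where
    here : ∀ {v} → InD v → ReachD v v
    step : ∀ {u v w} → ReachD u v → Adj v w → InD w → ReachD u w

-- The heart is a Gallai-type fact valid in every graph: if u, w ∈ D(G) are adjacent,
-- then uw lies on an odd cycle all of whose vertices are in D(G).  Take maximum
-- matchings M missing u and M′ missing w and walk u, a₁, b₁, a₂, b₂, …, where aᵢ is
-- the M′-mate of the previous vertex and bᵢ the M-mate of aᵢ.  Maximality forces these
-- mates to exist; switching M along u … bᵢ, resp. M′ along w u … aᵢ, yields maximum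
-- matchings missing bᵢ, resp. aᵢ, so the walk stays in D(G); and it never revisits a
-- vertex, so it ends at w, closing an odd cycle with the edge wu.
-- In an odd cycle disjoint graph, an edge of G[D(G)] leaving this cycle or chording it
-- would lie on a second odd cycle through a vertex of the first one; hence the
-- component of u is exactly the cycle.

module Submission where

open import Defs hiding (sym)
open import Data.Nat using (ℕ; zero; suc; _+_; _≤_; _%_; z≤n; s≤s)
open import Data.Nat.Properties using (≤-refl; ≤-trans; ≤-reflexive; ≤-antisym; +-suc; +-identityʳ; n≤1+n; 1+n≰n; suc-injective)
open import Data.Fin using (Fin; zero; suc; _≟_)
open import Data.Fin.Properties using (any?; injective⇒≤)
open import Data.Bool using (true) renaming (_≟_ to _≟ᵇ_)
open import Data.List using (List; []; _∷_; length; lookup; zip; _++_; [_])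
open import Data.List.Membership.Propositional using (_∈_; _∉_)
open import Data.List.Membership.Propositional.Properties using (∈-++⁻; ∈-++⁺ˡ; ∈-++⁺ʳ; ∈-lookup)
open import Data.List.Relation.Binary.Subset.Propositional using (_⊆_)
open import Data.List.Relation.Binary.Subset.Propositional.Properties using (concatMap⁺; ∷⁺ʳ)
open import Data.List.Relation.Unary.Any using (here; there)
open import Data.List.Relation.Unary.All using (All; []; _∷_; all?) renaming (lookup to All-lookup)
open import Data.List.Relation.Unary.All.Properties using (¬Any⇒All¬; anti-mono)
open import Data.List.Relation.Unary.AllPairs using (allPairs?)
open import Data.List.Relation.Unary.Unique.Propositional using (Unique; []; _∷_)
open import Data.List.Relation.Unary.Unique.Propositional.Properties using (Unique[x∷xs]⇒x∉xs)
open import Data.Product using (Σ; ∃; _×_; _,_; proj₁; proj₂)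
open import Data.Product.Properties using (≡-dec)
open import Data.Sum using (_⊎_; inj₁; inj₂)
open import Data.Empty using (⊥-elim)
open import Function using (_∘′_)
open import Relation.Binary.PropositionalEquality using (_≡_; _≢_; refl; sym; trans; cong; subst)
open import Relation.Nullary using (¬_; Dec; yes; no; ¬?)
open import Relation.Nullary.Decidable using (map′; _×-dec_)
open import Function.Bundles using (_⇔_; mk⇔; Equivalence)

lookup-injective : ∀ {A : Set} {xs : List A} → Unique xs → ∀ i j → lookup xs i ≡ lookup xs j → i ≡ j
lookup-injective (_ ∷ _) zero zero _ = refl
lookup-injective (x∉ ∷ _) zero (suc j) eq = ⊥-elim (All-lookup x∉ (∈-lookup j) eq)
lookup-injective (x∉ ∷ _) (suc i) zero eq = ⊥-elim (All-lookup x∉ (∈-lookup i) (sym eq))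
lookup-injective (_ ∷ u) (suc i) (suc j) eq = cong suc (lookup-injective u i j eq)

Unique⇒length≤ : ∀ {n} {xs : List (Fin n)} → Unique xs → length xs ≤ n
Unique⇒length≤ {xs = xs} u = injective⇒≤ {f = lookup xs} (λ {i} {j} → lookup-injective u i j)

module Graphs {n : ℕ} (G : Graph n) where

  Edge : Set
  Edge = Fin n × Fin n

  AdjPair : Edge → Set
  AdjPair p = Adj G (proj₁ p) (proj₂ p)

  Adj-sym : ∀ {a b} → Adj G a b → Adj G b a
  Adj-sym {a} {b} ab = trans (Graph.sym G b a) ab

  Adj⇒≢ : ∀ {a b} → Adj G a b → a ≢ b
  Adj⇒≢ {a} aa refl with trans (sym (Graph.irrefl G a)) aa
  ... | ()

module Matchings {n : ℕ} (G : Graph n) where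
  open Graphs G
  open import Data.List.Membership.DecPropositional (_≟_ {n}) using (_∈?_)

  Mate : List Edge → Fin n → Fin n → Set
  Mate M a b = (a , b) ∈ M ⊎ (b , a) ∈ M

  MateClosed : List Edge → List (Fin n) → Set
  MateClosed M S = ∀ {c d} → c ∈ S → Mate M c d → d ∈ S

  Mate-sym : ∀ {M a b} → Mate M a b → Mate M b a
  Mate-sym (inj₁ ab) = inj₂ ab
  Mate-sym (inj₂ ba) = inj₁ ba

  Mate-mono : ∀ {L M a b} → L ⊆ M → Mate L a b → Mate M a b
  Mate-mono L⊆M (inj₁ ab) = inj₁ (L⊆M ab)
  Mate-mono L⊆M (inj₂ ba) = inj₂ (L⊆M ba)

  Mate-∷⁻ : ∀ {p M a b} → Mate (p ∷ M) a b → Mate [ p ] a b ⊎ Mate M a b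
  Mate-∷⁻ (inj₁ (here eq)) = inj₁ (inj₁ (here eq))
  Mate-∷⁻ (inj₁ (there ab)) = inj₂ (inj₁ ab)
  Mate-∷⁻ (inj₂ (here eq)) = inj₁ (inj₂ (here eq))
  Mate-∷⁻ (inj₂ (there ba)) = inj₂ (inj₂ ba)

  Mate⇒Covers : ∀ {M a b} → Mate M a b → Covers G M a
  Mate⇒Covers {_ ∷ _} (inj₁ (here refl)) = here refl
  Mate⇒Covers {_ ∷ _} (inj₂ (here refl)) = there (here refl)
  Mate⇒Covers {_ ∷ _} (inj₁ (there ab)) = there (there (Mate⇒Covers (inj₁ ab)))
  Mate⇒Covers {_ ∷ _} (inj₂ (there ba)) = there (there (Mate⇒Covers (inj₂ ba)))

  Covers⇒Mate : ∀ {M a} → Covers G M a → ∃ (Mate M a)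
  Covers⇒Mate {(_ , b) ∷ _} (here refl) = b , inj₁ (here refl)
  Covers⇒Mate {(b , _) ∷ _} (there (here refl)) = b , inj₂ (here refl)
  Covers⇒Mate {_ ∷ _} (there (there a∈)) with Covers⇒Mate a∈
  ... | b , ab = b , Mate-mono there ab

  Covers-mono : ∀ {L M a} → L ⊆ M → Covers G L a → Covers G M a
  Covers-mono L⊆M = concatMap⁺ _ L⊆M

  Mate⇒Adj : ∀ {M a b} → IsMatching G M → Mate M a b → Adj G a b
  Mate⇒Adj (adjs , _) (inj₁ ab) = All-lookup adjs ab
  Mate⇒Adj (adjs , _) (inj₂ ba) = Adj-sym (All-lookup adjs ba)

  Mate-head⇒¬Covers-tail : ∀ {p M a b} → Unique (endpoints G (p ∷ M)) → Mate [ p ] a b → ¬ Covers G M a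
  Mate-head⇒¬Covers-tail (a∉ ∷ _) (inj₁ (here refl)) a∈ = All-lookup a∉ (there a∈) refl
  Mate-head⇒¬Covers-tail (_ ∷ a∉ ∷ _) (inj₂ (here refl)) a∈ = All-lookup a∉ a∈ refl

  Mate-unique : ∀ {M a b c} → Unique (endpoints G M) → Mate M a b → Mate M a c → b ≡ c
  Mate-unique {[]} _ (inj₁ ()) _
  Mate-unique {[]} _ (inj₂ ()) _
  Mate-unique {_ ∷ M} u@(_ ∷ _ ∷ u′) ab ac with Mate-∷⁻ ab | Mate-∷⁻ ac
  ... | inj₁ (inj₁ (here refl)) | inj₁ (inj₁ (here refl)) = refl
  ... | inj₁ (inj₁ (here refl)) | inj₁ (inj₂ (here refl)) = refl
  ... | inj₁ (inj₂ (here refl)) | inj₁ (inj₁ (here refl)) = refl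
  ... | inj₁ (inj₂ (here refl)) | inj₁ (inj₂ (here refl)) = refl
  ... | inj₁ ab₀ | inj₂ ac′ = ⊥-elim (Mate-head⇒¬Covers-tail {M = M} u ab₀ (Mate⇒Covers ac′))
  ... | inj₂ ab′ | inj₁ ac₀ = ⊥-elim (Mate-head⇒¬Covers-tail {M = M} u ac₀ (Mate⇒Covers ab′))
  ... | inj₂ ab′ | inj₂ ac′ = Mate-unique u′ ab′ ac′

  augment : ∀ {M a b} → IsMatching G M → Adj G a b → ¬ Covers G M a → ¬ Covers G M b →
            IsMatching G ((a , b) ∷ M)
  augment {M} {a} {b} (adjs , u) ab a∉ b∉ = ab ∷ adjs , ¬Any⇒All¬ _ a∉b∷M ∷ ¬Any⇒All¬ _ b∉ ∷ u
    where
    a∉b∷M : a ∉ b ∷ endpoints G M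
    a∉b∷M (here a≡b) = Adj⇒≢ ab a≡b
    a∉b∷M (there a∈) = a∉ a∈

  record Deletion (M : List Edge) (a b : Fin n) : Set where
    field
      rest : List Edge
      length-rest : length M ≡ suc (length rest)
      rest⊆ : rest ⊆ M
      a∉rest : ¬ Covers G rest a
      b∉rest : ¬ Covers G rest b
      rest-unique : Unique (endpoints G rest)

  ¬Covers-∷ : ∀ {p M L a} → Unique (endpoints G (p ∷ M)) → Covers G M a → ¬ Covers G L a →
              ¬ Covers G (p ∷ L) a
  ¬Covers-∷ (p₁∉ ∷ _) a∈M _ (here refl) = All-lookup p₁∉ (there a∈M) refl
  ¬Covers-∷ (_ ∷ p₂∉ ∷ _) a∈M _ (there (here refl)) = All-lookup p₂∉ a∈M refl
  ¬Covers-∷ _ _ a∉L (there (there a∈L)) = a∉L a∈L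

  delete : ∀ {M a b} → Unique (endpoints G M) → Mate M a b → Deletion M a b
  delete {[]} _ (inj₁ ())
  delete {[]} _ (inj₂ ())
  delete {p ∷ M} u@(p₁∉ ∷ p₂∉ ∷ u′) ab with Mate-∷⁻ ab
  ... | inj₁ ab₀ = record
    { rest = M
    ; length-rest = refl
    ; rest⊆ = there
    ; a∉rest = Mate-head⇒¬Covers-tail {M = M} u ab₀
    ; b∉rest = Mate-head⇒¬Covers-tail {M = M} u (Mate-sym ab₀)
    ; rest-unique = u′
    }
  ... | inj₂ ab′ = record
    { rest = p ∷ rest
    ; length-rest = cong suc length-rest
    ; rest⊆ = ∷⁺ʳ p rest⊆
    ; a∉rest = ¬Covers-∷ {M = M} {L = rest} u (Mate⇒Covers ab′) a∉rest
    ; b∉rest = ¬Covers-∷ {M = M} {L = rest} u (Mate⇒Covers (Mate-sym ab′)) b∉rest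
    ; rest-unique = anti-mono (∷⁺ʳ _ ep⊆) p₁∉ ∷ anti-mono ep⊆ p₂∉ ∷ rest-unique
    }
    where
    open Deletion (delete u′ ab′)
    ep⊆ : endpoints G rest ⊆ endpoints G M
    ep⊆ = Covers-mono rest⊆

  record Swap (M : List Edge) (x a b : Fin n) : Set where
    field
      swapped : List Edge
      isMatching : IsMatching G swapped
      length-swapped : length swapped ≡ length M
      b-free : ¬ Covers G swapped b
      x-a : Mate swapped x a
      old-mates : ∀ {c d} → c ≢ x → c ≢ a → Mate swapped c d → Mate M c d

  swap : ∀ {M x a b} → IsMatching G M → Mate M a b → Adj G x a → ¬ Covers G M x → Swap M x a b
  swap {M} {x} {a} {b} (adjs , u) ab xa x-free = record
    { swapped = (x , a) ∷ rest
    ; isMatching = augment (anti-mono rest⊆ adjs , rest-unique) xa (x-free ∘′ Covers-mono rest⊆) a∉rest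
    ; length-swapped = sym length-rest
    ; b-free = b-free
    ; x-a = inj₁ (here refl)
    ; old-mates = old-mates
    }
    where
    open Deletion (delete u ab)
    b-free : ¬ Covers G ((x , a) ∷ rest) b
    b-free (here refl) = x-free (Mate⇒Covers (Mate-sym ab))
    b-free (there (here refl)) = Adj⇒≢ (Mate⇒Adj (adjs , u) ab) refl
    b-free (there (there b∈)) = b∉rest b∈
    old-mates : ∀ {c d} → c ≢ x → c ≢ a → Mate ((x , a) ∷ rest) c d → Mate M c d
    old-mates c≢x c≢a cd with Mate-∷⁻ cd
    ... | inj₁ (inj₁ (here refl)) = ⊥-elim (c≢x refl)
    ... | inj₁ (inj₂ (here refl)) = ⊥-elim (c≢a refl)
    ... | inj₂ cd′ = Mate-mono rest⊆ cd′

  free-closed : ∀ {M S c} → ¬ Covers G M c → MateClosed M S → MateClosed M (c ∷ S)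
  free-closed c-free _ (here refl) cd = ⊥-elim (c-free (Mate⇒Covers cd))
  free-closed _ closed (there c∈S) cd = there (closed c∈S cd)

  Swap-closed : ∀ {M S x a b} (s : Swap M x a b) → MateClosed M S → x ∈ S →
                MateClosed (Swap.swapped s) (a ∷ S)
  Swap-closed {S = S} {x} {a} s closed x∈S = closed′
    where
    open Swap s
    uniq : Unique (endpoints G swapped)
    uniq = proj₂ isMatching
    closed′ : MateClosed swapped (a ∷ S)
    closed′ {c} c∈ cd with c ≟ x | c ≟ a | c∈
    ... | yes refl | _ | _ = here (Mate-unique uniq cd x-a)
    ... | no _ | yes refl | _ = there (subst (_∈ S) (Mate-unique uniq (Mate-sym x-a) cd) x∈S)
    ... | no _ | no c≢a | here c≡a = ⊥-elim (c≢a c≡a)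
    ... | no c≢x | no c≢a | there c∈S = there (closed c∈S (old-mates c≢x c≢a cd))

  maximum-of-same-length : ∀ {M M′} → IsMaximumMatching G M → IsMatching G M′ → length M′ ≡ length M →
                           IsMaximumMatching G M′
  maximum-of-same-length max M′-matching eq =
    M′-matching , λ L L-matching → subst (length L ≤_) (sym eq) (proj₂ max L L-matching)

  Swap-maximum : ∀ {M x a b} → IsMaximumMatching G M → (s : Swap M x a b) → IsMaximumMatching G (Swap.swapped s)
  Swap-maximum max s = maximum-of-same-length max (Swap.isMatching s) (Swap.length-swapped s)

  free-neighbour-covered : ∀ {M a b} → IsMaximumMatching G M → Adj G a b → ¬ Covers G M a → Covers G M b
  free-neighbour-covered {M} {b = b} max ab a-free with b ∈? endpoints G M
  ... | yes b∈ = b∈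
  ... | no b-free = ⊥-elim (1+n≰n (proj₂ max _ (augment (proj₁ max) ab a-free b-free)))

module OddDCycles {n : ℕ} (G : Graph n) where
  open Graphs G
  open Matchings G

  record OddDCycleThrough (u w : Fin n) : Set where
    field
      cycle : List (Fin n)
      isOddCycle : IsOddCycle G cycle
      uw∈ : (u , w) ∈ cycPairs G cycle
      ⊆D : All (InD G) cycle

  -- e ∷ rest is the walk built so far, read backwards from its current end e to u, so
  -- that e ∷ rest ++ [ w ] is a path.  Mₑ is M switched along the walk (missing e) and
  -- N is M′ switched along w u … (missing the predecessor p of e); both match the
  -- vertices of the walk among themselves.
  record AlternatingPath (u w e : Fin n) (rest : List (Fin n)) : Set where
    field
      distinct : Unique (e ∷ rest)
      w∉ : w ∉ e ∷ rest
      edges : All AdjPair (zip (e ∷ rest) (rest ++ [ w ]))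
      uw∈ : (u , w) ∈ zip (e ∷ rest) (rest ++ [ w ])
      odd : length (e ∷ rest) % 2 ≡ 1
      ⊆D : All (InD G) (e ∷ rest)
      Mₑ : List Edge
      Mₑ-max : IsMaximumMatching G Mₑ
      e-free : ¬ Covers G Mₑ e
      Mₑ-closed : MateClosed Mₑ (e ∷ rest)
      N : List Edge
      N-max : IsMaximumMatching G N
      p : Fin n
      p∈ : p ∈ rest ++ [ w ]
      p-free : ¬ Covers G N p
      p-e : Adj G p e
      N-closed : MateClosed N (rest ++ [ w ])

  start : ∀ {u w M M′} → IsMaximumMatching G M → ¬ Covers G M u → IsMaximumMatching G M′ → ¬ Covers G M′ w →
          Adj G u w → AlternatingPath u w u []
  start {w = w} {M} {M′} M-max u-free M′-max w-free uw = record
    { distinct = [] ∷ []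
    ; w∉ = λ { (here w≡u) → Adj⇒≢ uw (sym w≡u) }
    ; edges = uw ∷ []
    ; uw∈ = here refl
    ; odd = refl
    ; ⊆D = (M , M-max , u-free) ∷ []
    ; Mₑ = M ; Mₑ-max = M-max ; e-free = u-free
    ; Mₑ-closed = free-closed u-free (λ ())
    ; N = M′ ; N-max = M′-max ; p = w ; p∈ = here refl ; p-free = w-free ; p-e = Adj-sym uw
    ; N-closed = free-closed w-free (λ ())
    }

  module Extend {u w e rest} (P : AlternatingPath u w e rest) where
    open AlternatingPath P

    e∉rest++w : e ∉ rest ++ [ w ]
    e∉rest++w e∈ with ∈-++⁻ rest e∈
    ... | inj₁ e∈rest = Unique[x∷xs]⇒x∉xs distinct e∈rest
    ... | inj₂ (here e≡w) = w∉ (here (sym e≡w))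

    e-mate : ∃ (Mate N e)
    e-mate = Covers⇒Mate (free-neighbour-covered N-max p-e p-free)

    a : Fin n
    a = proj₁ e-mate

    e-a : Mate N e a
    e-a = proj₂ e-mate

    a-e : Adj G a e
    a-e = Adj-sym (Mate⇒Adj (proj₁ N-max) e-a)

    a∉ : a ∉ e ∷ rest ++ [ w ]
    a∉ (here a≡e) = Adj⇒≢ a-e a≡e
    a∉ (there a∈) = e∉rest++w (N-closed a∈ (Mate-sym e-a))

    a-mate : ∃ (Mate Mₑ a)
    a-mate = Covers⇒Mate (free-neighbour-covered Mₑ-max (Adj-sym a-e) e-free)

    b : Fin n
    b = proj₁ a-mate

    a-b : Mate Mₑ a b
    a-b = proj₂ a-mate

    b-a : Adj G b a
    b-a = Adj-sym (Mate⇒Adj (proj₁ Mₑ-max) a-b)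

    b∉ : b ∉ a ∷ e ∷ rest
    b∉ (here b≡a) = Adj⇒≢ b-a b≡a
    b∉ (there b∈) = a∉ (∈-++⁺ˡ (Mₑ-closed b∈ (Mate-sym a-b)))

    Mₑ-swap : Swap Mₑ e a b
    Mₑ-swap = swap (proj₁ Mₑ-max) a-b (Adj-sym a-e) e-free

    N-swap : Swap N p e a
    N-swap = swap (proj₁ N-max) e-a p-e p-free

    distinct′ : Unique (b ∷ a ∷ e ∷ rest)
    distinct′ = ¬Any⇒All¬ _ b∉ ∷ ¬Any⇒All¬ _ (a∉ ∘′ ∈-++⁺ˡ) ∷ distinct

    pairsClosedBy : Fin n → List Edge
    pairsClosedBy x = zip (b ∷ a ∷ e ∷ rest) (a ∷ e ∷ rest ++ [ x ])

    edges′ : All AdjPair (pairsClosedBy w)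
    edges′ = b-a ∷ a-e ∷ edges

    ⊆D′ : All (InD G) (b ∷ a ∷ e ∷ rest)
    ⊆D′ = (Swap.swapped Mₑ-swap , Swap-maximum Mₑ-max Mₑ-swap , Swap.b-free Mₑ-swap)
        ∷ (Swap.swapped N-swap , Swap-maximum N-max N-swap , Swap.b-free N-swap)
        ∷ ⊆D

    close : b ≡ w → OddDCycleThrough u w
    close b≡w = record
      { cycle = b ∷ a ∷ e ∷ rest
      ; isOddCycle = (distinct′ , s≤s (s≤s (s≤s z≤n)) , subst (All AdjPair ∘′ pairsClosedBy) (sym b≡w) edges′) , odd
      ; uw∈ = subst (λ x → (u , w) ∈ pairsClosedBy x) (sym b≡w) (there (there uw∈))
      ; ⊆D = ⊆D′
      }

    extend : b ≢ w → AlternatingPath u w b (a ∷ e ∷ rest)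
    extend b≢w = record
      { distinct = distinct′
      ; w∉ = w∉′
      ; edges = edges′
      ; uw∈ = there (there uw∈)
      ; odd = odd
      ; ⊆D = ⊆D′
      ; Mₑ = Swap.swapped Mₑ-swap
      ; Mₑ-max = Swap-maximum Mₑ-max Mₑ-swap
      ; e-free = Swap.b-free Mₑ-swap
      ; Mₑ-closed = free-closed (Swap.b-free Mₑ-swap) (Swap-closed Mₑ-swap Mₑ-closed (here refl))
      ; N = Swap.swapped N-swap
      ; N-max = Swap-maximum N-max N-swap
      ; p = a
      ; p∈ = here refl
      ; p-free = Swap.b-free N-swap
      ; p-e = Adj-sym b-a
      ; N-closed = free-closed (Swap.b-free N-swap) (Swap-closed N-swap N-closed p∈)
      }
      where
      w∉′ : w ∉ b ∷ a ∷ e ∷ rest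
      w∉′ (here w≡b) = b≢w (sym w≡b)
      w∉′ (there (here w≡a)) = a∉ (there (∈-++⁺ʳ rest (here (sym w≡a))))
      w∉′ (there (there w∈)) = w∉ w∈

  complete : ∀ {u w} fuel {e rest} → suc n ≤ length (e ∷ rest) + fuel →
             AlternatingPath u w e rest → OddDCycleThrough u w
  complete zero bound P =
    ⊥-elim (1+n≰n (≤-trans bound (≤-trans (≤-reflexive (+-identityʳ _)) (Unique⇒length≤ (AlternatingPath.distinct P)))))
  complete {w = w} (suc fuel) bound P with Extend.b P ≟ w
  ... | yes b≡w = Extend.close P b≡w
  ... | no b≢w = complete fuel (≤-trans bound (≤-trans (≤-reflexive (+-suc _ fuel)) (n≤1+n _))) (Extend.extend P b≢w)

  oddDCycleThrough : ∀ {u w} → InD G u → InD G w → Adj G u w → OddDCycleThrough u w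
  oddDCycleThrough (M , M-max , u-free) (M′ , M′-max , w-free) uw =
    complete n ≤-refl (start M-max u-free M′-max w-free uw)

module DecidableD {n : ℕ} (G : Graph n) where
  open import Data.List.Membership.DecPropositional (_≟_ {n}) using (_∈?_)

  any-pair? : {Q : Fin n × Fin n → Set} → (∀ p → Dec (Q p)) → Dec (∃ Q)
  any-pair? Q? = map′ (λ { (i , j , q) → (i , j) , q }) (λ { ((i , j) , q) → i , j , q })
                      (any? λ i → any? λ j → Q? (i , j))

  any-list-of-length? : (m : ℕ) {P : List (Fin n × Fin n) → Set} → (∀ L → Dec (P L)) →
                        Dec (∃ λ L → length L ≡ m × P L)
  any-list-of-length? zero P? with P? []
  ... | yes p = yes ([] , refl , p)
  ... | no ¬p = no λ { ([] , refl , p) → ¬p p }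
  any-list-of-length? (suc m) P? with any-pair? (λ q → any-list-of-length? m (λ L → P? (q ∷ L)))
  ... | yes (q , L , eq , p) = yes (q ∷ L , cong suc eq , p)
  ... | no ¬p = no λ { (q ∷ L , eq , p) → ¬p (q , L , suc-injective eq , p) }

  IsMatching? : ∀ M → Dec (IsMatching G M)
  IsMatching? M = all? (λ q → adj G (proj₁ q) (proj₂ q) ≟ᵇ true) M ×-dec allPairs? (λ x y → ¬? (x ≟ y)) (endpoints G M)

  InD? : ∀ {M} → IsMaximumMatching G M → ∀ x → Dec (InD G x)
  InD? {M} M-max x =
    map′ to from (any-list-of-length? (length M) (λ L → IsMatching? L ×-dec ¬? (x ∈? endpoints G L)))
    where
    open Matchings G using (maximum-of-same-length)
    to : (∃ λ L → length L ≡ length M × IsMatching G L × ¬ Covers G L x) → InD G x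
    to (L , eq , L-matching , x-free) = L , maximum-of-same-length M-max L-matching eq , x-free
    from : InD G x → ∃ λ L → length L ≡ length M × IsMatching G L × ¬ Covers G L x
    from (L , L-max , x-free) =
      L , ≤-antisym (proj₂ M-max L (proj₁ L-max)) (proj₂ L-max M (proj₁ M-max)) , proj₁ L-max , x-free

  D-neighbour? : ∀ {v} → InD G v → Dec (∃ λ w → Adj G v w × InD G w)
  D-neighbour? {v} (_ , M-max , _) = any? λ w → (adj G v w ≟ᵇ true) ×-dec InD? M-max w

∈-zip⁻ : ∀ {A B : Set} {xs : List A} {ys : List B} {a b} → (a , b) ∈ zip xs ys → a ∈ xs × b ∈ ys
∈-zip⁻ {xs = _ ∷ _} {_ ∷ _} (here refl) = here refl , here refl
∈-zip⁻ {xs = _ ∷ _} {_ ∷ _} (there ab) with ∈-zip⁻ ab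
... | a∈ , b∈ = there a∈ , there b∈

module CycleEdges {n : ℕ} (G : Graph n) where
  open Graphs G using (AdjPair; Adj-sym)
  open import Data.List.Membership.DecPropositional (≡-dec (_≟_ {n}) (_≟_ {n})) using (_∈?_)

  ∈-cycPairs⁻ : ∀ {C a b} → (a , b) ∈ cycPairs G C → a ∈ C × b ∈ C
  ∈-cycPairs⁻ {c ∷ cs} ab with ∈-zip⁻ {xs = c ∷ cs} ab
  ... | a∈ , b∈ with ∈-++⁻ cs b∈
  ...   | inj₁ b∈cs = a∈ , there b∈cs
  ...   | inj₂ (here refl) = a∈ , here refl

  CycEdge⇒∈ : ∀ {C a b} → CycEdge G C a b → a ∈ C × b ∈ C
  CycEdge⇒∈ (inj₁ ab) = ∈-cycPairs⁻ ab
  CycEdge⇒∈ (inj₂ ba) with ∈-cycPairs⁻ ba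
  ... | b∈ , a∈ = a∈ , b∈

  CycEdge⇒Adj : ∀ {C a b} → All AdjPair (cycPairs G C) → CycEdge G C a b → Adj G a b
  CycEdge⇒Adj edges (inj₁ ab) = All-lookup edges ab
  CycEdge⇒Adj edges (inj₂ ba) = Adj-sym (All-lookup edges ba)

  CycEdge? : ∀ C a b → Dec (CycEdge G C a b)
  CycEdge? C a b with (a , b) ∈? cycPairs G C | (b , a) ∈? cycPairs G C
  ... | yes ab | _ = yes (inj₁ ab)
  ... | no _ | yes ba = yes (inj₂ ba)
  ... | no ¬ab | no ¬ba = no λ { (inj₁ ab) → ¬ab ab ; (inj₂ ba) → ¬ba ba }

module Reachability {n : ℕ} (G : Graph n) where
  open Graphs G using (AdjPair; Adj-sym)

  ReachD-end : ∀ {a b} → ReachD G a b → InD G b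
  ReachD-end (here b∈D) = b∈D
  ReachD-end (step _ _ b∈D) = b∈D

  ReachD-trans : ∀ {a b c} → ReachD G a b → ReachD G b c → ReachD G a c
  ReachD-trans ab (here _) = ab
  ReachD-trans ab (step bc cd d∈D) = step (ReachD-trans ab bc) cd d∈D

  ReachD-sym : ∀ {a b} → ReachD G a b → ReachD G b a
  ReachD-sym (here a∈D) = here a∈D
  ReachD-sym (step ab bc c∈D) = ReachD-trans (step (here c∈D) (Adj-sym bc) (ReachD-end ab)) (ReachD-sym ab)

  ReachD-isolated : ∀ {v w} → ¬ (∃ λ x → Adj G v x × InD G x) → ReachD G v w → w ≡ v
  ReachD-isolated _ (here _) = refl
  ReachD-isolated isolated (step vw wx x∈D) with ReachD-isolated isolated vw
  ... | refl = ⊥-elim (isolated (_ , wx , x∈D))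

  ReachD-closed : ∀ {S v w} → (∀ {y x} → y ∈ S → Adj G y x → InD G x → x ∈ S) → v ∈ S → ReachD G v w → w ∈ S
  ReachD-closed _ v∈S (here _) = v∈S
  ReachD-closed closed v∈S (step vy yx x∈D) = closed (ReachD-closed closed v∈S vy) yx x∈D

  ReachD-along : ∀ {a l z y} → All AdjPair (zip (a ∷ l) (l ++ [ z ])) → All (InD G) (a ∷ l) → y ∈ a ∷ l →
                 ReachD G a y
  ReachD-along _ (a∈D ∷ _) (here refl) = here a∈D
  ReachD-along {l = _ ∷ _} (ab ∷ edges) (a∈D ∷ ⊆D) (there y∈) =
    ReachD-trans (step (here a∈D) ab (All-lookup ⊆D (here refl))) (ReachD-along edges ⊆D y∈)

  ReachD-cycle : ∀ {C a x} → All AdjPair (cycPairs G C) → All (InD G) C → a ∈ C → x ∈ C → ReachD G a x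
  ReachD-cycle {_ ∷ _} edges ⊆D a∈ x∈ = ReachD-trans (ReachD-sym (ReachD-along edges ⊆D a∈)) (ReachD-along edges ⊆D x∈)

module OddCycleDisjointGraphs {n : ℕ} {G : Graph n} (disjoint : OddCycleDisjoint G) where
  open Graphs G using (AdjPair)
  open OddDCycles G
  open CycleEdges G
  open Reachability G
  open OddDCycleThrough

  D-edge⇒CycEdge : ∀ {u w y x} (Z : OddDCycleThrough u w) → y ∈ cycle Z → Adj G y x → InD G x →
                   CycEdge G (cycle Z) y x
  D-edge⇒CycEdge Z y∈ yx x∈D with CycEdge? (cycle Z) _ _
  ... | yes e = e
  ... | no ¬e = ⊥-elim (disjoint (cycle Z) (cycle Z′) (isOddCycle Z) (isOddCycle Z′) different _ y∈
                                 (proj₁ (∈-cycPairs⁻ (uw∈ Z′))))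
    where
    Z′ = oddDCycleThrough (All-lookup (⊆D Z) y∈) x∈D yx
    different : ¬ SameCycle G (cycle Z) (cycle Z′)
    different same = ¬e (Equivalence.from (same _ _) (inj₁ (uw∈ Z′)))

  component-is-odd-cycle : ∀ {v w} → InD G v → InD G w → Adj G v w →
    Σ (List (Fin n)) λ C → IsOddCycle G C
      × (∀ x → ReachD G v x ⇔ x ∈ C)
      × (∀ a b → a ∈ C → b ∈ C → Adj G a b ⇔ CycEdge G C a b)
  component-is-odd-cycle {v} v∈D w∈D vw =
    cycle Z , isOddCycle Z ,
    (λ _ → mk⇔ (ReachD-closed closed v∈C) (ReachD-cycle edges (⊆D Z) v∈C)) ,
    (λ _ _ a∈ b∈ → mk⇔ (λ ab → D-edge⇒CycEdge Z a∈ ab (All-lookup (⊆D Z) b∈)) (CycEdge⇒Adj {cycle Z} edges))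
    where
    Z : OddDCycleThrough v _
    Z = oddDCycleThrough v∈D w∈D vw
    edges : All AdjPair (cycPairs G (cycle Z))
    edges = proj₂ (proj₂ (proj₁ (isOddCycle Z)))
    v∈C : v ∈ cycle Z
    v∈C = proj₁ (∈-cycPairs⁻ (uw∈ Z))
    closed : ∀ {y x} → y ∈ cycle Z → Adj G y x → InD G x → x ∈ cycle Z
    closed y∈ yx x∈D = proj₂ (CycEdge⇒∈ (D-edge⇒CycEdge Z y∈ yx x∈D))

mainTheorem15 : (n : ℕ) (G : Graph n) → OddCycleDisjoint G →
    (v : Fin n) → InD G v →
      (∀ w → ReachD G v w → w ≡ v)
      ⊎ Σ (List (Fin n)) (λ C → IsOddCycle G C
          × (∀ w → ReachD G v w ⇔ w ∈ C)
          × (∀ u w → u ∈ C → w ∈ C → Adj G u w ⇔ CycEdge G C u w))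
mainTheorem15 n G disjoint v v∈D with DecidableD.D-neighbour? G v∈D
... | no isolated = inj₁ λ _ → Reachability.ReachD-isolated G isolated
... | yes (w , vw , w∈D) = inj₂ (OddCycleDisjointGraphs.component-is-odd-cycle disjoint v∈D w∈D vw)
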